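{- Let $text$ be a string of length $n$, and let $t$ be the length of the longest suffix of $text$ that occurs at least twice in $text$. If $text[1..n-1]$ is squarefree and, for some positive integer $k$, the suffix $text[n-k+1..n]$ is a square, then $t < k \le 2t$.
   Context: Strings are indexed from $1$; $w[a..c] = w[a]\cdots w[c]$. A square is a string $xx$ with $x$ nonempty; a string is squarefree if none of its substrings is a square. Occurrences of a substring may overlap. -}

module Defs where

open import Data.List using (List; []; _∷_; _++_; length)
open import Data.Nat using (ℕ; _≤_)
open import Data.Product using (Σ; ∃; _×_)
open import Relation.Binary.PropositionalEquality using (_≡_; _≢_)
open import Relation.Nullary using (¬_)

-- w[1..n-1]: drop the last letter (the empty string stays empty)
dropLast : {A : Set} → List A → List A
dropLast []           = []
dropLast (x ∷ [])     = []
dropLast (x ∷ y ∷ xs) = x ∷ dropLast (y ∷ xs)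

IsSquare : {A : Set} → List A → Set
IsSquare {A} s = Σ (List A) λ x → (x ≢ []) × (s ≡ x ++ x)

Squarefree : {A : Set} → List A → Set
Squarefree {A} w = (u s v : List A) → w ≡ u ++ s ++ v → ¬ IsSquare s

-- s occurs in w starting at position i+1 (i letters before it)
OccursAt : {A : Set} → List A → List A → ℕ → Set
OccursAt {A} s w i = Σ (List A) λ u → Σ (List A) λ v → (w ≡ u ++ s ++ v) × (length u ≡ i)

OccursTwice : {A : Set} → List A → List A → Set
OccursTwice s w = Σ ℕ λ i → Σ ℕ λ j → (i ≢ j) × OccursAt s w i × OccursAt s w j

IsSuffix : {A : Set} → List A → List A → Set
IsSuffix {A} s w = Σ (List A) λ p → w ≡ p ++ s

LongestRepeatedSuffixLength : {A : Set} → List A → ℕ → Set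
LongestRepeatedSuffixLength {A} w t =
  (Σ (List A) λ s → IsSuffix s w × OccursTwice s w × (length s ≡ t))
  × ((s : List A) → IsSuffix s w → OccursTwice s w → length s ≤ t)

module Submission where

--  * k ≤ 2t: the half x is a suffix of `text` and occurs twice in it (once at
--    the end, once just before), so |x| ≤ t and k = 2|x| ≤ 2t.
--  * t < k: a suffix r occurring twice occurs at least once NOT at the very
--    end (two occurrences ending at the end of `text` coincide), so r is a
--    substring of dropLast text and hence squarefree.  If |r| ≥ k, the square
--    suffix s would be a suffix of r, contradicting squarefreeness.

open import Defs
open import Data.List using (List; []; _∷_; _++_; _∷ʳ_; length; initLast; _∷ʳ′_)
open import Data.List.Properties using (length-++; length-++-≤ʳ; ++-assoc; ++-identityʳ; ∷-injectiveʳ)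
open import Data.Nat using (ℕ; _≤_; _<_; _*_; _+_; s≤s)
open import Data.Nat.Properties using (+-cancelʳ-≡; +-identityʳ; +-comm; +-mono-≤; m≢1+n+m; <⇒≱; ≮⇒≥; _<?_; module ≤-Reasoning)
open import Data.Product using (_×_; _,_; Σ; proj₁; proj₂)
open import Data.Empty using (⊥-elim)
open import Relation.Nullary using (¬_; yes; no)
open import Relation.Binary.PropositionalEquality

suffix-of-suffix : {A : Set} (a b c d : List A) → a ++ b ≡ c ++ d →
  length d ≤ length b → Σ (List A) λ e → b ≡ e ++ d
suffix-of-suffix []      b c       d eq le = c , eq
suffix-of-suffix (x ∷ a) b []      d eq le =
  ⊥-elim (<⇒≱ (subst (length b <_) (cong length eq) (s≤s (length-++-≤ʳ b {a}))) le)
suffix-of-suffix (x ∷ a) b (y ∷ c) d eq le = suffix-of-suffix a b c d (∷-injectiveʳ eq) le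

dropLast-∷ʳ : {A : Set} (w : List A) (a : A) → dropLast (w ∷ʳ a) ≡ w
dropLast-∷ʳ []          a = refl
dropLast-∷ʳ (y ∷ [])    a = refl
dropLast-∷ʳ (y ∷ z ∷ w) a = cong (y ∷_) (dropLast-∷ʳ (z ∷ w) a)

inner-occurrence-survives-dropLast : {A : Set} (w u s v : List A) →
  w ≡ u ++ s ++ v → v ≢ [] → Σ (List A) λ v′ → dropLast w ≡ u ++ s ++ v′
inner-occurrence-survives-dropLast w u s v eq v≢[] with initLast v
... | []        = ⊥-elim (v≢[] refl)
... | v′ ∷ʳ′ a  = v′ , (begin
  dropLast w                       ≡⟨ cong dropLast eq ⟩
  dropLast (u ++ s ++ v′ ∷ʳ a)     ≡⟨ cong dropLast (regroup u s v′) ⟩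
  dropLast ((u ++ s ++ v′) ∷ʳ a)   ≡⟨ dropLast-∷ʳ (u ++ s ++ v′) a ⟩
  u ++ s ++ v′                     ∎)
  where
  open ≡-Reasoning
  regroup : (u s v′ : List _) → u ++ s ++ v′ ∷ʳ a ≡ (u ++ s ++ v′) ∷ʳ a
  regroup u s v′ = begin
    u ++ s ++ (v′ ++ a ∷ [])    ≡⟨ cong (u ++_) (sym (++-assoc s v′ _)) ⟩
    u ++ (s ++ v′) ++ a ∷ []    ≡⟨ sym (++-assoc u (s ++ v′) _) ⟩
    (u ++ s ++ v′) ++ a ∷ []    ∎

final-occurrence-unique : {A : Set} (w u₁ u₂ s : List A) →
  w ≡ u₁ ++ s ++ [] → w ≡ u₂ ++ s ++ [] → length u₁ ≡ length u₂
final-occurrence-unique w u₁ u₂ s e₁ e₂ = +-cancelʳ-≡ (length (s ++ [])) (length u₁) (length u₂)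
  (begin
    length u₁ + length (s ++ [])   ≡⟨ sym (length-++ u₁) ⟩
    length (u₁ ++ s ++ [])         ≡⟨ cong length (trans (sym e₁) e₂) ⟩
    length (u₂ ++ s ++ [])         ≡⟨ length-++ u₂ ⟩
    length u₂ + length (s ++ [])   ∎)
  where open ≡-Reasoning

-- A string occurring twice in w occurs in dropLast w: at most one of the two
-- occurrences can end at the last letter of w.
repeated-occurs-in-dropLast : {A : Set} (s w : List A) → OccursTwice s w →
  Σ (List A) λ u → Σ (List A) λ v → dropLast w ≡ u ++ s ++ v
repeated-occurs-in-dropLast s w (i , j , i≢j , (u₁ , v₁ , e₁ , l₁) , (u₂ , v₂ , e₂ , l₂)) =
  by-final-segments v₁ v₂ e₁ e₂
  where
  by-final-segments : (v₁ v₂ : List _) → w ≡ u₁ ++ s ++ v₁ → w ≡ u₂ ++ s ++ v₂ →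
    Σ (List _) λ u → Σ (List _) λ v → dropLast w ≡ u ++ s ++ v
  by-final-segments (a ∷ v₁) v₂ e₁ e₂ = u₁ , inner-occurrence-survives-dropLast w u₁ s _ e₁ (λ ())
  by-final-segments [] (a ∷ v₂) e₁ e₂ = u₂ , inner-occurrence-survives-dropLast w u₂ s _ e₂ (λ ())
  by-final-segments [] [] e₁ e₂ =
    ⊥-elim (i≢j (trans (sym l₁) (trans (final-occurrence-unique w u₁ u₂ s e₁ e₂) l₂)))

squarefree-infix : {A : Set} (w u s v : List A) → Squarefree w → w ≡ u ++ s ++ v → Squarefree s
squarefree-infix w u s v sqf eq u′ s′ v′ eq′ = sqf (u ++ u′) s′ (v′ ++ v) (begin
  w                          ≡⟨ eq ⟩
  u ++ s ++ v                ≡⟨ cong (λ z → u ++ z ++ v) eq′ ⟩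
  u ++ (u′ ++ s′ ++ v′) ++ v ≡⟨ cong (u ++_) (++-assoc u′ (s′ ++ v′) v) ⟩
  u ++ u′ ++ (s′ ++ v′) ++ v ≡⟨ cong (λ z → u ++ u′ ++ z) (++-assoc s′ v′ v) ⟩
  u ++ u′ ++ s′ ++ v′ ++ v   ≡⟨ sym (++-assoc u u′ _) ⟩
  (u ++ u′) ++ s′ ++ v′ ++ v ∎)
  where open ≡-Reasoning

squarefree-no-square-suffix : {A : Set} (r q s : List A) → Squarefree r → r ≡ q ++ s → ¬ IsSquare s
squarefree-no-square-suffix r q s sqf eq = sqf q s [] (trans eq (cong (q ++_) (sym (++-identityʳ s))))

repeated-suffix-shorter-than-square : {A : Set} (w r p s : List A) →
  Squarefree (dropLast w) → IsSuffix r w → OccursTwice r w →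
  w ≡ p ++ s → IsSquare s → length r < length s
repeated-suffix-shorter-than-square w r p s sqf (pr , w≡pr++r) twice w≡p++s square
  with length r <? length s
... | yes r<s = r<s
... | no  r≮s with suffix-of-suffix pr r p s (trans (sym w≡pr++r) w≡p++s) (≮⇒≥ r≮s)
...   | q , r≡q++s = ⊥-elim (squarefree-no-square-suffix r q s r-squarefree r≡q++s square)
  where
  r-squarefree : Squarefree r
  r-squarefree with repeated-occurs-in-dropLast r w twice
  ... | u , v , eq = squarefree-infix (dropLast w) u r v sqf eq

nonempty-extension-longer : {A : Set} (p y : List A) → y ≢ [] → length p ≢ length (p ++ y)
nonempty-extension-longer p []      y≢[] _  = y≢[] refl
nonempty-extension-longer p (a ∷ y) _    eq =
  m≢1+n+m (length p) (trans eq (trans (length-++ p) (+-comm (length p) _)))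

square-half-is-repeated-suffix : {A : Set} (w p x : List A) → x ≢ [] →
  w ≡ p ++ x ++ x → IsSuffix x w × OccursTwice x w
square-half-is-repeated-suffix w p x x≢[] eq =
  (p ++ x , trans eq (sym (++-assoc p x x))) ,
  (length p , length (p ++ x) , nonempty-extension-longer p x x≢[] ,
   (p , x , eq , refl) ,
   (p ++ x , [] , trans eq (trans (sym (++-assoc p x x)) (cong ((p ++ x) ++_) (sym (++-identityʳ x)))) , refl))

lemma3 : {A : Set} (text : List A) (t k : ℕ) →
    LongestRepeatedSuffixLength text t →
    Squarefree (dropLast text) →
    0 < k →
    (p s : List A) → text ≡ p ++ s → length s ≡ k →
    IsSquare s →
    (t < k) × (k ≤ 2 * t)
lemma3 text t k ((r , r-suffix , r-twice , |r|≡t) , longest) sqf _ p s text≡p++s |s|≡k (x , x≢[] , s≡xx) =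
  t<k , k≤2t
  where
  t<k : t < k
  t<k = subst₂ _<_ |r|≡t |s|≡k
    (repeated-suffix-shorter-than-square text r p s sqf r-suffix r-twice text≡p++s (x , x≢[] , s≡xx))
  half-repeats : IsSuffix x text × OccursTwice x text
  half-repeats = square-half-is-repeated-suffix text p x x≢[] (trans text≡p++s (cong (p ++_) s≡xx))
  |x|≤t : length x ≤ t
  |x|≤t = longest x (proj₁ half-repeats) (proj₂ half-repeats)
  k≤2t : k ≤ 2 * t
  k≤2t = begin
    k                      ≡⟨ sym |s|≡k ⟩
    length s               ≡⟨ cong length s≡xx ⟩
    length (x ++ x)        ≡⟨ length-++ x ⟩
    length x + length x    ≤⟨ +-mono-≤ |x|≤t |x|≤t ⟩
    t + t                  ≡⟨ cong (t +_) (sym (+-identityʳ t)) ⟩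
    2 * t                  ∎
    where open ≤-Reasoning
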